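{- Let $n=p^\ell m$, where $p$ is a prime and $\ell\geq 1$, $m\geq 2$ are integers. Let $\mathrm{Cay}(\mathbb{Z}_n, R)$ and $\mathrm{Cay}(\mathbb{Z}_n,S)$ be distinct circulant graphs (i.e. $R\neq S$) with $|R|=|S|=p^\ell-1$. Then $\bar{f}_{m}(R_0)\cap\bar{f}_{m}(S_0)=\emptyset$.
   Context: For inverse-closed $S\subseteq\mathbb{Z}_n\setminus\{0\}$, $S_0=S\cup\{0\}$; elements of $\mathbb{Z}_n$ are identified with integers in $\{0,\dots,n-1\}$. A map $\sigma:S_0\to\{0,1,\dots,m-1\}$ is feasible if $\sigma(0)=0$ and $T(\sigma)=\{s+\sigma(s)n:s\in S\}$ satisfies $-T(\sigma)=T(\sigma)$ in $\mathbb{Z}_{mn}$. With $T(\sigma)_0=T(\sigma)\cup\{0\}=\{s+\sigma(s)n:s\in S_0\}\subseteq\mathbb{Z}_{mn}$, define $\bar f_m(S_0)=\{T(\sigma)_0:\sigma:S_0\to\{0,\dots,m-1\}\text{ feasible}\}$, a family of subsets of $\mathbb{Z}_{mn}$. -}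

module Defs where

open import Data.Nat using (ℕ; zero; suc; _+_; _*_; _∸_)
open import Data.Fin using (Fin; toℕ)
open import Data.Fin.Subset using (Subset; _∈_)
open import Data.Product using (Σ; _×_)
open import Data.Sum using (_⊎_)
open import Relation.Binary.PropositionalEquality using (_≡_)

-- Negation in Z_N, elements of Z_N identified with naturals in {0,…,N-1}.
negN : ℕ → ℕ → ℕ
negN N zero    = zero
negN N (suc y) = N ∸ suc y

InvClosed : {n : ℕ} → Subset n → Set
InvClosed {n} S =
  (∀ x → x ∈ S → toℕ x ≡ 0 → Data.Empty.⊥) ×
  (∀ x y → x ∈ S → toℕ y ≡ negN n (toℕ x) → y ∈ S)
  where import Data.Empty

_∈₀_ : {n : ℕ} → Fin n → Subset n → Set
x ∈₀ S = (x ∈ S) ⊎ (toℕ x ≡ 0)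

lift : {n m : ℕ} → (Fin n → Fin m) → Fin n → ℕ
lift {n} σ s = toℕ s + toℕ (σ s) * n

T : {n m : ℕ} → Subset n → (Fin n → Fin m) → ℕ → Set
T S σ y = Σ _ λ s → (s ∈ S) × (y ≡ lift σ s)

T₀ : {n m : ℕ} → Subset n → (Fin n → Fin m) → ℕ → Set
T₀ S σ y = Σ _ λ s → (s ∈₀ S) × (y ≡ lift σ s)

Feasible : {n m : ℕ} → Subset n → (Fin n → Fin m) → Set
Feasible {n} {m} S σ =
  (∀ s → toℕ s ≡ 0 → toℕ (σ s) ≡ 0) ×
  ((∀ y → T S σ y → T S σ (negN (m * n) y)) ×
   (∀ z → T S σ z → Σ ℕ λ y → T S σ y × (z ≡ negN (m * n) y)))

-- A ∈ f̄_m(S₀): A = T(σ)₀ for some feasible σ : S₀ → {0,…,m-1}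
-- (subsets of Z_{mn} are predicates on ℕ; set equality is pointwise ↔)
InFbar : (m : ℕ) {n : ℕ} → Subset n → (ℕ → Set) → Set
InFbar m {n} S A =
  Σ (Fin n → Fin m) λ σ → Feasible S σ ×
    (∀ y → (A y → T₀ S σ y) × (T₀ S σ y → A y))

{-# OPTIONS --safe #-}
-- Reducing s + σ(s) n modulo n gives back s, so every member T(σ)₀ of
-- f̄_m(S₀) determines S₀ = T(σ)₀ mod n. Hence f̄_m(R₀) and f̄_m(S₀) can only
-- share a member when R₀ = S₀, i.e. R = S as 0 ∉ R, S.
module Submission where

open import Defs
open import Data.Nat using (ℕ; _+_; _*_; _^_; _∸_; _≥_)
open import Data.Nat.Primality using (Prime)
open import Data.Nat.Properties using (+-comm; *-comm)
open import Data.Fin using (Fin; toℕ; combine)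
open import Data.Fin.Properties using (toℕ-injective; toℕ-combine; combine-injectiveʳ)
open import Data.Fin.Subset using (Subset; ∣_∣; _∈_; _⊆_)
open import Data.Fin.Subset.Properties using (⊆-antisym)
open import Data.Product using (_,_; proj₁; proj₂)
open import Data.Sum using (inj₁; inj₂)
open import Data.Empty using (⊥; ⊥-elim)
open import Relation.Nullary using (¬_)
open import Relation.Binary.PropositionalEquality
  using (_≡_; _≢_; refl; sym; trans; cong; subst; module ≡-Reasoning)

module _ {n m : ℕ} where

  lift≡toℕ-combine : (σ : Fin n → Fin m) (s : Fin n) →
    lift σ s ≡ toℕ (combine (σ s) s)
  lift≡toℕ-combine σ s = begin
    toℕ s + toℕ (σ s) * n  ≡⟨ +-comm (toℕ s) _ ⟩
    toℕ (σ s) * n + toℕ s  ≡⟨ cong (_+ toℕ s) (*-comm (toℕ (σ s)) n) ⟩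
    n * toℕ (σ s) + toℕ s  ≡⟨ toℕ-combine (σ s) s ⟨
    toℕ (combine (σ s) s)  ∎
    where open ≡-Reasoning

  lift-injective : (σ τ : Fin n → Fin m) {s t : Fin n} →
    lift σ s ≡ lift τ t → s ≡ t
  lift-injective σ τ {s} {t} eq =
    combine-injectiveʳ (σ s) s (τ t) t
      (toℕ-injective (trans (sym (lift≡toℕ-combine σ s))
                            (trans eq (lift≡toℕ-combine τ t))))

  InFbar-∈₀ : {R S : Subset n} {A : ℕ → Set} →
    InFbar m R A → InFbar m S A → {s : Fin n} → s ∈₀ R → s ∈₀ S
  InFbar-∈₀ (σ , _ , A≡T₀R) (τ , _ , A≡T₀S) {s} s∈₀R
    with proj₁ (A≡T₀S (lift σ s)) (proj₂ (A≡T₀R (lift σ s)) (s , s∈₀R , refl))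
  ... | t , t∈₀S , σs≡τt = subst (_∈₀ _) (sym (lift-injective σ τ σs≡τt)) t∈₀S

  InFbar-⊆ : {R S : Subset n} {A : ℕ → Set} →
    (∀ x → x ∈ R → toℕ x ≢ 0) →
    InFbar m R A → InFbar m S A → R ⊆ S
  InFbar-⊆ 0∉R fR fS {s} s∈R with InFbar-∈₀ fR fS (inj₁ s∈R)
  ... | inj₁ s∈S = s∈S
  ... | inj₂ s≡0 = ⊥-elim (0∉R s s∈R s≡0)

lemma4p9 : (p ℓ m n : ℕ) → Prime p → ℓ ≥ 1 → m ≥ 2 → n ≡ p ^ ℓ * m →
    (R S : Subset n) → InvClosed R → InvClosed S → ¬ (R ≡ S) →
    ∣ R ∣ ≡ p ^ ℓ ∸ 1 → ∣ S ∣ ≡ p ^ ℓ ∸ 1 →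
    (A : ℕ → Set) → InFbar m R A → InFbar m S A → ⊥
lemma4p9 p ℓ m n _ _ _ _ R S icR icS R≢S _ _ A fR fS =
  R≢S (⊆-antisym (InFbar-⊆ (proj₁ icR) fR fS) (InFbar-⊆ (proj₁ icS) fS fR))
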